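{- Let $\mathbf{f}$ be the Fibonacci word and $\mathbf{t}=T(\mathbf{f})$. Then $\mathcal{L}_{\mathbf{t}}=T(\mathcal{L}_{\mathbf{f}})\cup\overline{T}(\mathcal{L}_{\mathbf{f}})$.
   Context: $\varphi=(1+\sqrt5)/2$, $\alpha=2-\varphi$, $\mathbf{f}=(\lfloor (n+1)\alpha\rfloor-\lfloor n\alpha\rfloor)_{n\ge1}$. For a (finite or infinite) word over $\{0,1\}$, $T$ keeps each $1$ and, among the occurrences of $0$ in order, keeps the 1st, 3rd, 5th, $\dots$ and replaces the 2nd, 4th, 6th, $\dots$ by $2$; $\overline{T}$ keeps each $1$ and replaces the 1st, 3rd, 5th, $\dots$ occurrences of $0$ by $2$, keeping the others. $\mathcal{L}_{\mathbf{w}}$ is the set of factors of $\mathbf{w}$, and $T(\mathcal{L}_{\mathbf f})=\{T(w):w\in\mathcal{L}_{\mathbf f}\}$, similarly for $\overline T$. -}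

module Defs where

open import Data.Nat using (ℕ; zero; suc; _+_; _*_; _∸_; _≤ᵇ_)
open import Data.Nat.Properties using (_≟_)
open import Data.Bool using (Bool; true; false; not; if_then_else_; _∧_)
open import Data.List using (List; []; _∷_; map; length)
open import Data.List.Base using (upTo)
open import Data.Product using (Σ; ∃; _×_; _,_)
open import Relation.Binary.PropositionalEquality using (_≡_)
open import Relation.Nullary.Decidable using (⌊_⌋)

-- Exact integer computation of ⌊ n α ⌋ with α = 2 - φ = (3 - √5)/2.
-- For k ≥ 1:  k ≤ n α  ⇔  2k ≤ 3n - n√5  ⇔  2k ≤ 3n  ∧  5n² ≤ (3n - 2k)².
-- Since n α ≥ 0 and n α < n, ⌊ n α ⌋ = #{ k ∈ {1,…,n} : k ≤ n α }.
belowNα : ℕ → ℕ → Bool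
belowNα n k = ((2 * k) ≤ᵇ (3 * n)) ∧ ((5 * (n * n)) ≤ᵇ ((3 * n ∸ 2 * k) * (3 * n ∸ 2 * k)))

countUpTo : (ℕ → Bool) → ℕ → ℕ
countUpTo p zero = zero
countUpTo p (suc m) = (if p (suc m) then 1 else 0) + countUpTo p m

floorNα : ℕ → ℕ
floorNα n = countUpTo (belowNα n) n

-- Fibonacci word, 0-indexed: fib i = 𝐟_{i+1} = ⌊(i+2)α⌋ - ⌊(i+1)α⌋.
-- Letters are natural numbers (alphabet {0,1,2} ⊆ ℕ).
fib : ℕ → ℕ
fib i = floorNα (suc (suc i)) ∸ floorNα (suc i)

-- The Bool flag says whether the next
-- occurrence of 0 is an odd-numbered one (1st, 3rd, ...).
-- Odd-numbered 0s are kept when the flag rule is T, replaced by 2 for T̄.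
Tgo : Bool → List ℕ → List ℕ
Tgo b [] = []
Tgo b (zero ∷ w) = (if b then 0 else 2) ∷ Tgo (not b) w
Tgo b (suc x ∷ w) = suc x ∷ Tgo b w

T : List ℕ → List ℕ
T = Tgo true

T̄ : List ℕ → List ℕ
T̄ = Tgo false

-- Applying T to an infinite word: position i becomes the i-th letter of
-- T applied to the prefix of length i+1.
isZero : ℕ → Bool
isZero zero = true
isZero (suc _) = false

zerosBefore : (ℕ → ℕ) → ℕ → ℕ
zerosBefore w zero = zero
zerosBefore w (suc i) = (if isZero (w i) then 1 else 0) + zerosBefore w i

even : ℕ → Bool
even zero = true
even (suc n) = not (even n)

Tω : (ℕ → ℕ) → (ℕ → ℕ)
Tω w i with w i
... | zero = if even (zerosBefore w i) then 0 else 2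
... | suc x = suc x

tw : ℕ → ℕ
tw = Tω fib

factor : (ℕ → ℕ) → ℕ → ℕ → List ℕ
factor w i zero = []
factor w i (suc n) = w i ∷ factor w (suc i) n

InLang : (ℕ → ℕ) → List ℕ → Set
InLang w u = Σ ℕ λ i → factor w i (length u) ≡ u

-- The factor of Tω w at position i is T or T̄ of the factor of w at
-- i, according to the parity of the number of 0s of w before i
-- (factor-Tω).  So L(Tω w) = T(L_w) ∪ T̄(L_w) holds for every word w in
-- which each factor recurs with the opposite parity of preceding 0s
-- (ParityRecurrent, language-Tω).
--
-- Arithmetic.  m = ⌊nα⌋ is certified by the gap g = 3n − 2(m + 1) with
-- g < n√5 ≤ g + 2 (IsFloor); such a certificate determines floorNα n.
-- Floors increase by 0 or 1 per step, so f has i − ⌊(i+1)α⌋ zeros before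
-- position i.  For a Cassini pair d² = p² + pd + 1 with F = p + d ≥ 8n,
-- ⌊(n + F)α⌋ = ⌊nα⌋ + p, because L = p + 3d satisfies L² = 5F² + 4.
--
-- Hence f agrees with its shift by F on a long prefix, and the shift adds
-- d zeros.  Taking the pairs (F₆ₖ, F₆ₖ₊₁), where d is odd and F is as large
-- as needed, shows that f is parity-recurrent, and lemma14 follows.

module Submission where

open import Defs
open import Data.Bool using (Bool; true; false; not; if_then_else_) renaming (T to IsTrue)
open import Data.Bool.Properties using (T-∧; ¬-not; not-involutive) renaming (_≟_ to _≟ᵇ_)
open import Data.Empty using (⊥-elim)
open import Data.List using (List; []; _∷_; length)
open import Data.Nat
open import Data.Nat.Properties
open import Data.Nat.Tactic.RingSolver using (solve-∀)
open import Data.Product using (Σ; _×_; _,_; proj₁; proj₂)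
open import Data.Sum using (_⊎_; inj₁; inj₂)
import Data.Sum as Sum
open import Data.Unit using (tt)
open import Function.Bundles using (_⇔_; mk⇔; Equivalence)
open import Relation.Nullary using (¬_; yes; no)
open import Relation.Binary.PropositionalEquality

ParityRecurrent : (ℕ → ℕ) → Set
ParityRecurrent w = ∀ i n → Σ ℕ λ j →
  factor w j n ≡ factor w i n × even (zerosBefore w j) ≡ not (even (zerosBefore w i))

length-factor : ∀ (w : ℕ → ℕ) i n → length (factor w i n) ≡ n
length-factor w i zero = refl
length-factor w i (suc n) = cong suc (length-factor w (suc i) n)

length-Tgo : ∀ b v → length (Tgo b v) ≡ length v
length-Tgo b [] = refl
length-Tgo b (zero ∷ v) = cong suc (length-Tgo (not b) v)
length-Tgo b (suc x ∷ v) = cong suc (length-Tgo b v)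

factor-Tω : ∀ w i n → factor (Tω w) i n ≡ Tgo (even (zerosBefore w i)) (factor w i n)
factor-Tω w i zero = refl
factor-Tω w i (suc n) with w i | factor-Tω w (suc i) n
... | zero | rest = cong (_ ∷_) rest
... | suc x | rest = cong (suc x ∷_) rest

occurrence-with-parity : ∀ {w} → ParityRecurrent w → ∀ {v} i → factor w i (length v) ≡ v →
  ∀ b → Σ ℕ λ j → factor w j (length v) ≡ v × even (zerosBefore w j) ≡ b
occurrence-with-parity {w} recurrent {v} i occ b
  with even (zerosBefore w i) ≟ᵇ b | recurrent i (length v)
... | yes same | _ = i , occ , same
... | no differ | j , repeat , flipped =
  j , trans repeat occ , trans flipped (trans (cong not (¬-not differ)) (not-involutive b))

language-Tω : ∀ w → ParityRecurrent w → ∀ u →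
  InLang (Tω w) u ⇔ ((Σ (List ℕ) λ v → InLang w v × T v ≡ u)
                    ⊎ (Σ (List ℕ) λ v → InLang w v × T̄ v ≡ u))
language-Tω w recurrent u = mk⇔ decode encode
  where
  Images : Set
  Images = (Σ (List ℕ) λ v → InLang w v × T v ≡ u) ⊎ (Σ (List ℕ) λ v → InLang w v × T̄ v ≡ u)

  decode : InLang (Tω w) u → Images
  decode (i , occ) = image (even (zerosBefore w i)) (trans (sym (factor-Tω w i (length u))) occ)
    where
    v : List ℕ
    v = factor w i (length u)
    v∈L : InLang w v
    v∈L = i , cong (factor w i) (length-factor w i (length u))
    image : ∀ b → Tgo b v ≡ u → Images
    image true e = inj₁ (v , v∈L , e)
    image false e = inj₂ (v , v∈L , e)

  realise : ∀ b {v} i → factor w i (length v) ≡ v → Tgo b v ≡ u → InLang (Tω w) u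
  realise b {v} i occ e with occurrence-with-parity recurrent i occ b
  ... | j , occ′ , parity = j , (let open ≡-Reasoning in begin
    factor (Tω w) j (length u)   ≡⟨ cong (factor (Tω w) j) (trans (sym (cong length e)) (length-Tgo b v)) ⟩
    factor (Tω w) j (length v)   ≡⟨ factor-Tω w j (length v) ⟩
    Tgo (even (zerosBefore w j)) (factor w j (length v)) ≡⟨ cong₂ Tgo parity occ′ ⟩
    Tgo b v                      ≡⟨ e ⟩
    u                            ∎)

  encode : Images → InLang (Tω w) u
  encode (inj₁ (v , (i , occ) , e)) = realise true i occ e
  encode (inj₂ (v , (i , occ) , e)) = realise false i occ e

≤-by : ∀ {a b} c → a + c ≡ b → a ≤ b
≤-by {a} c refl = m≤m+n a c

square-cancel-≤ : ∀ a b → a * a ≤ b * b → a ≤ b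
square-cancel-≤ a b a²≤b² with a ≤? b
... | yes a≤b = a≤b
... | no a≰b = ⊥-elim (<⇒≱ (*-mono-< (≰⇒> a≰b) (≰⇒> a≰b)) a²≤b²)

≤-from-balance : ∀ {a b c r} → a + c ≡ b + r → r ≤ c → a ≤ b
≤-from-balance {a} {b} {c} {r} e r≤c =
  +-cancelʳ-≤ c a b (subst (_≤ b + c) (sym e) (+-monoʳ-≤ b r≤c))

-- a ≥ n√5 and c ≥ f√5 imply a + c ≥ (n + f)√5 (all stated via squares).
add-≥√5 : ∀ {n f a c} → 5 * (n * n) ≤ a * a → 5 * (f * f) ≤ c * c →
  5 * ((n + f) * (n + f)) ≤ (a + c) * (a + c)
add-≥√5 {n} {f} {a} {c} n≤a f≤c =
  subst₂ _≤_ (sym (expand n f)) (square a c)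
    (+-mono-≤ (+-mono-≤ n≤a (*-monoʳ-≤ 2 product)) f≤c)
  where
  -- (5nf)² = 5n²·5f² ≤ a²c² = (ac)²
  product : 5 * n * f ≤ a * c
  product = square-cancel-≤ _ _
    (subst₂ _≤_ (sym (regroup₁ n f)) (regroup₂ a c) (*-mono-≤ n≤a f≤c))
    where
    regroup₁ : ∀ n f → (5 * n * f) * (5 * n * f) ≡ (5 * (n * n)) * (5 * (f * f))
    regroup₁ = solve-∀
    regroup₂ : ∀ a c → (a * a) * (c * c) ≡ (a * c) * (a * c)
    regroup₂ = solve-∀
  expand : ∀ n f → 5 * ((n + f) * (n + f)) ≡ 5 * (n * n) + 2 * (5 * n * f) + 5 * (f * f)
  expand = solve-∀
  square : ∀ a c → a * a + 2 * (a * c) + c * c ≡ (a + c) * (a + c)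
  square = solve-∀

large-dominates : ∀ {n f} → 8 * n ≤ f → 20 * (n * n) + 4 * (3 * n * (3 * f)) ≤ 5 * (f * f)
large-dominates {n} h with m≤n⇒∃[o]m+o≡n h
... | e , refl = ≤-by (12 * (n * n) + 44 * (n * e) + 5 * (e * e)) (identity n e)
  where
  identity : ∀ n e → 20 * (n * n) + 4 * (3 * n * (3 * (8 * n + e)))
                       + (12 * (n * n) + 44 * (n * e) + 5 * (e * e))
                     ≡ 5 * ((8 * n + e) * (8 * n + e))
  identity = solve-∀

-- Let b < n√5 (with 5n² = b² + D, D ≥ 1) and c² = 5f² + 4.  If b ≤ 3n,
-- c ≤ 3f and f ≥ 8n, then bc + 2 ≤ 5nf: the defect D(5f² + 4) exceeds
-- what (bc + 2)² gains over (bc)².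
gap-product-bound : ∀ {n f b c D} → b * b + suc D ≡ 5 * (n * n) → c * c ≡ 5 * (f * f) + 4 →
  b ≤ 3 * n → c ≤ 3 * f → 8 * n ≤ f → b * c + 2 ≤ 5 * n * f
gap-product-bound {n} {f} {b} {c} {D} hb hc b≤3n c≤3f large =
  square-cancel-≤ _ _ (≤-from-balance balance slack)
  where
  balance : (b * c + 2) * (b * c + 2) + suc D * (5 * (f * f) + 4)
          ≡ (5 * n * f) * (5 * n * f) + (20 * (n * n) + 4 * (b * c) + 4)
  balance = let open ≡-Reasoning in begin
    (b * c + 2) * (b * c + 2) + suc D * (5 * (f * f) + 4)
      ≡⟨ cong (λ x → (b * c + 2) * (b * c + 2) + suc D * x) (sym hc) ⟩
    (b * c + 2) * (b * c + 2) + suc D * (c * c)   ≡⟨ expand b c (suc D) ⟩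
    (b * b + suc D) * (c * c) + (4 * (b * c) + 4)
      ≡⟨ cong₂ (λ x y → x * y + (4 * (b * c) + 4)) hb hc ⟩
    5 * (n * n) * (5 * (f * f) + 4) + (4 * (b * c) + 4)   ≡⟨ regroup n f (b * c) ⟩
    (5 * n * f) * (5 * n * f) + (20 * (n * n) + 4 * (b * c) + 4) ∎
    where
    expand : ∀ b c D → (b * c + 2) * (b * c + 2) + D * (c * c)
                     ≡ (b * b + D) * (c * c) + (4 * (b * c) + 4)
    expand = solve-∀
    regroup : ∀ n f x → 5 * (n * n) * (5 * (f * f) + 4) + (4 * x + 4)
                      ≡ (5 * n * f) * (5 * n * f) + (20 * (n * n) + 4 * x + 4)
    regroup = solve-∀
  slack : 20 * (n * n) + 4 * (b * c) + 4 ≤ suc D * (5 * (f * f) + 4)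
  slack = ≤-trans
    (+-monoˡ-≤ 4 (≤-trans (+-monoʳ-≤ (20 * (n * n)) (*-monoʳ-≤ 4 (*-mono-≤ b≤3n c≤3f)))
                          (large-dominates {n} large)))
    (m≤m+n (5 * (f * f) + 4) (D * (5 * (f * f) + 4)))

add-<√5 : ∀ {n f b c} → b * b < 5 * (n * n) → c * c ≡ 5 * (f * f) + 4 →
  b ≤ 3 * n → c ≤ 3 * f → 8 * n ≤ f → (b + c) * (b + c) < 5 * ((n + f) * (n + f))
add-<√5 {n} {f} {b} {c} b<n√5 hc b≤3n c≤3f large with m≤n⇒∃[o]m+o≡n b<n√5
... | D , defect = begin-strict
  (b + c) * (b + c)                                     <⟨ m<m+n _ (s≤s z≤n) ⟩
  (b + c) * (b + c) + suc D                             ≡⟨ expand b c (suc D) ⟩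
  (b * b + suc D) + 2 * (b * c) + c * c                 ≡⟨ cong₂ (λ x y → x + 2 * (b * c) + y) hb hc ⟩
  5 * (n * n) + 2 * (b * c) + (5 * (f * f) + 4)         ≡⟨ regroup (n * n) (b * c) (f * f) ⟩
  5 * (n * n) + 2 * (b * c + 2) + 5 * (f * f)
    ≤⟨ +-monoˡ-≤ (5 * (f * f)) (+-monoʳ-≤ (5 * (n * n)) (*-monoʳ-≤ 2
         (gap-product-bound {n} {f} hb hc b≤3n c≤3f large))) ⟩
  5 * (n * n) + 2 * (5 * n * f) + 5 * (f * f)           ≡⟨ square n f ⟩
  5 * ((n + f) * (n + f))                               ∎
  where
  open ≤-Reasoning
  hb : b * b + suc D ≡ 5 * (n * n)
  hb = trans (+-suc (b * b) D) defect
  expand : ∀ b c D → (b + c) * (b + c) + D ≡ (b * b + D) + 2 * (b * c) + c * c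
  expand = solve-∀
  regroup : ∀ x y z → 5 * x + 2 * y + (5 * z + 4) ≡ 5 * x + 2 * (y + 2) + 5 * z
  regroup = solve-∀
  square : ∀ n f → 5 * (n * n) + 2 * (5 * n * f) + 5 * (f * f) ≡ 5 * ((n + f) * (n + f))
  square = solve-∀

belowNα-gap : ∀ {n k a} → 3 * n ≡ a + 2 * k → IsTrue (belowNα n k) ⇔ 5 * (n * n) ≤ a * a
belowNα-gap {n} {k} {a} split = mk⇔
  (λ t → subst (λ x → 5 * (n * n) ≤ x * x) difference (≤ᵇ⇒≤ _ _ (proj₂ (Equivalence.to T-∧ t))))
  (λ h → Equivalence.from T-∧
    (≤⇒≤ᵇ (≤-by a (trans (+-comm (2 * k) a) (sym split))) ,
     ≤⇒≤ᵇ (subst (λ x → 5 * (n * n) ≤ x * x) (sym difference) h)))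
  where
  difference : 3 * n ∸ 2 * k ≡ a
  difference = trans (cong (_∸ 2 * k) split) (m+n∸n≡m a (2 * k))

belowNα-antitone : ∀ n k → IsTrue (belowNα n (suc k)) → IsTrue (belowNα n k)
belowNα-antitone n k t with m≤n⇒∃[o]m+o≡n (≤ᵇ⇒≤ _ _ (proj₁ (Equivalence.to T-∧ t)))
... | a , split =
  Equivalence.from (belowNα-gap {n} {k} {2 + a} (trans (sym split) (shift k a)))
    (≤-trans (Equivalence.to (belowNα-gap {n} {suc k} {a} (trans (sym split) (+-comm (2 * suc k) a))) t)
             (*-mono-≤ (m≤n+m a 2) (m≤n+m a 2)))
  where
  shift : ∀ k a → 2 * suc k + a ≡ (2 + a) + 2 * k
  shift = solve-∀

count-if-true : ∀ {b} x → IsTrue b → (if b then 1 else 0) + x ≡ suc x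
count-if-true {true} x _ = refl

count-if-false : ∀ {b} x → ¬ IsTrue b → (if b then 1 else 0) + x ≡ x
count-if-false {true} x ¬t = ⊥-elim (¬t tt)
count-if-false {false} x _ = refl

module Threshold (p : ℕ → Bool) (antitone : ∀ k → IsTrue (p (suc k)) → IsTrue (p k)) where

  count-initial : ∀ M → IsTrue (p M) → countUpTo p M ≡ M
  count-initial zero _ = refl
  count-initial (suc M) pM =
    trans (count-if-true (countUpTo p M) pM) (cong suc (count-initial M (antitone M pM)))

  fails-above : ∀ M → ¬ IsTrue (p (suc M)) → ∀ c → ¬ IsTrue (p (suc (c + M)))
  fails-above M ¬pM zero = ¬pM
  fails-above M ¬pM (suc c) t = fails-above M ¬pM c (antitone (suc (c + M)) t)

  count-beyond : ∀ M → ¬ IsTrue (p (suc M)) → ∀ c → countUpTo p (c + M) ≡ countUpTo p M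
  count-beyond M ¬pM zero = refl
  count-beyond M ¬pM (suc c) =
    trans (count-if-false (countUpTo p (c + M)) (fails-above M ¬pM c)) (count-beyond M ¬pM c)

  count-threshold : ∀ {M N} → IsTrue (p M) → ¬ IsTrue (p (suc M)) → M ≤ N → countUpTo p N ≡ M
  count-threshold {M} pM ¬pM M≤N with m≤n⇒∃[o]m+o≡n M≤N
  ... | c , refl = trans (cong (countUpTo p) (+-comm M c))
                         (trans (count-beyond M ¬pM c) (count-initial M pM))

-- m = ⌊nα⌋, certified by the gap g = 3n − 2(m + 1), which satisfies
-- g < n√5 ≤ g + 2 (since m ≤ nα < m + 1 means 3n − 2(m+1) < n√5 ≤ 3n − 2m).
record IsFloor (n m : ℕ) : Set where
  constructor gap
  field
    g     : ℕ
    split : 3 * n ≡ g + 2 * suc m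
    lower : g * g < 5 * (n * n)
    upper : 5 * (n * n) ≤ (2 + g) * (2 + g)

module _ {n m : ℕ} (fl : IsFloor n m) where
  open IsFloor fl

  gap-≤ : g ≤ 3 * n
  gap-≤ = ≤-by (2 * suc m) (sym split)

  -- 2n ≤ n√5 ≤ g + 2
  double-≤-gap : 2 * n ≤ 2 + g
  double-≤-gap = square-cancel-≤ _ _ (≤-trans (≤-by (n * n) (four n)) upper)
    where
    four : ∀ n → (2 * n) * (2 * n) + n * n ≡ 5 * (n * n)
    four = solve-∀

  -- ⌊nα⌋ ≤ n, as 2n + 2m ≤ (g + 2) + 2m = 3n.
  isFloor-≤ : m ≤ n
  isFloor-≤ = ≤-trans (m≤m+n m (m + 0))
    (+-cancelˡ-≤ (2 * n) _ _ (subst (2 * n + 2 * m ≤_) (trans (sym (regroup g m)) (trans (sym split) (three n)))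
                                   (+-monoˡ-≤ (2 * m) double-≤-gap)))
    where
    regroup : ∀ g m → g + 2 * suc m ≡ (2 + g) + 2 * m
    regroup = solve-∀
    three : ∀ n → 3 * n ≡ 2 * n + n
    three = solve-∀

  isFloor-unique : floorNα n ≡ m
  isFloor-unique = Threshold.count-threshold (belowNα n) (belowNα-antitone n)
    (Equivalence.from (belowNα-gap {n} {m} {2 + g} (trans split (regroup g m))) upper)
    (λ t → <⇒≱ lower (Equivalence.to (belowNα-gap {n} {suc m} {g} split) t))
    isFloor-≤
    where
    regroup : ∀ g m → g + 2 * suc m ≡ (2 + g) + 2 * m
    regroup = solve-∀

isFloor-step : ∀ {n m} → IsFloor n m → IsFloor (suc n) m ⊎ IsFloor (suc n) (suc m)
isFloor-step {n} {m} fl@(gap g split lower upper) with (3 + g) * (3 + g) <? 5 * (suc n * suc n)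
... | yes below = inj₁ (gap (3 + g) (trans (*-suc 3 n) (cong (3 +_) split)) below upper-stay)
  where
  -- (5 + g)² = (2 + g)² + 6(2 + g) + 9 ≥ 5n² + 5·2n + 5
  upper-stay : 5 * (suc n * suc n) ≤ (5 + g) * (5 + g)
  upper-stay = subst₂ _≤_ (sym (expand₁ n)) (sym (expand₂ g))
    (+-mono-≤ (+-mono-≤ upper (*-mono-≤ (≤-by {5} 1 refl) (double-≤-gap fl))) (≤-by {5} 4 refl))
    where
    expand₁ : ∀ n → 5 * (suc n * suc n) ≡ 5 * (n * n) + 5 * (2 * n) + 5
    expand₁ = solve-∀
    expand₂ : ∀ g → (5 + g) * (5 + g) ≡ (2 + g) * (2 + g) + 6 * (2 + g) + 9
    expand₂ = solve-∀
... | no ¬below = inj₂ (gap (suc g) split-rise lower-rise (≮⇒≥ ¬below))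
  where
  split-rise : 3 * suc n ≡ suc g + 2 * suc (suc m)
  split-rise = trans (*-suc 3 n) (trans (cong (3 +_) split) (regroup g m))
    where
    regroup : ∀ g m → 3 + (g + 2 * suc m) ≡ suc g + 2 * suc (suc m)
    regroup = solve-∀
  -- (1 + g)² = g² + 2g + 1 < 5n² + 6n + 1 ≤ 5(n + 1)²
  lower-rise : suc g * suc g < 5 * (suc n * suc n)
  lower-rise = subst₂ _≤_ (sym (expand₁ g)) (expand₂ n)
    (≤-trans (+-monoˡ-≤ 1 (+-mono-≤ lower (*-monoʳ-≤ 2 (gap-≤ fl))))
             (m≤m+n _ (4 * n + 4)))
    where
    expand₁ : ∀ g → suc (suc g * suc g) ≡ suc (g * g) + 2 * g + 1
    expand₁ = solve-∀
    expand₂ : ∀ n → 5 * (n * n) + 2 * (3 * n) + 1 + (4 * n + 4) ≡ 5 * (suc n * suc n)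
    expand₂ = solve-∀

-- (p, d) with d² = p² + pd + 1, e.g. consecutive Fibonacci numbers (F₂ₖ, F₂ₖ₊₁).
record Cassini (p d : ℕ) : Set where
  constructor cassini
  field identity : d * d ≡ p * p + p * d + 1

-- For a Cassini pair, L = p + 3d and F = p + d satisfy L² = 5F² + 4
-- (they are the Lucas and Fibonacci numbers of index 2k + 2).
cassini-lucas : ∀ {p d} → Cassini p d → (p + 3 * d) * (p + 3 * d) ≡ 5 * ((p + d) * (p + d)) + 4
cassini-lucas {p} {d} (cassini cas) = let open ≡-Reasoning in begin
  (p + 3 * d) * (p + 3 * d)                             ≡⟨ expand p d ⟩
  p * p + 6 * (p * d) + 5 * (d * d) + 4 * (d * d)       ≡⟨ cong (λ x → p * p + 6 * (p * d) + 5 * (d * d) + 4 * x) cas ⟩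
  p * p + 6 * (p * d) + 5 * (d * d) + 4 * (p * p + p * d + 1) ≡⟨ regroup p d ⟩
  5 * ((p + d) * (p + d)) + 4                           ∎
  where
  expand : ∀ p d → (p + 3 * d) * (p + 3 * d) ≡ p * p + 6 * (p * d) + 5 * (d * d) + 4 * (d * d)
  expand = solve-∀
  regroup : ∀ p d → p * p + 6 * (p * d) + 5 * (d * d) + 4 * (p * p + p * d + 1) ≡ 5 * ((p + d) * (p + d)) + 4
  regroup = solve-∀

-- Shifting n by F = p + d ≥ 8n adds p to the floor: (n + F)α has the gap
-- g + L, where g is the gap of nα and L = p + 3d ≈ F√5.
isFloor-shift : ∀ {n m p d} → Cassini p d → 8 * n ≤ p + d →
  IsFloor n m → IsFloor (n + (p + d)) (p + m)
isFloor-shift {n} {m} {p} {d} cas large fl@(gap g split lower upper) =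
  gap (g + (p + 3 * d)) split-shift
    (add-<√5 {n} {p + d} {g} {p + 3 * d} lower lucas (gap-≤ fl) (≤-by (2 * p) (triple p d)) large)
    (add-≥√5 {n} {p + d} {2 + g} {p + 3 * d} upper (≤-by 4 (sym lucas)))
  where
  lucas : (p + 3 * d) * (p + 3 * d) ≡ 5 * ((p + d) * (p + d)) + 4
  lucas = cassini-lucas cas
  triple : ∀ p d → p + 3 * d + 2 * p ≡ 3 * (p + d)
  triple = solve-∀
  split-shift : 3 * (n + (p + d)) ≡ (g + (p + 3 * d)) + 2 * suc (p + m)
  split-shift = trans (*-distribˡ-+ 3 n (p + d)) (trans (cong (_+ 3 * (p + d)) split) (regroup g m p d))
    where
    regroup : ∀ g m p d → g + 2 * suc m + 3 * (p + d) ≡ (g + (p + 3 * d)) + 2 * suc (p + m)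
    regroup = solve-∀

floor-exists : ∀ n → Σ ℕ (IsFloor (suc n))
floor-exists zero = 0 , gap 1 refl (≤-by 3 refl) (≤-by 4 refl)
floor-exists (suc n) with floor-exists n
... | m , fl with isFloor-step fl
...   | inj₁ stay = m , stay
...   | inj₂ rise = suc m , rise

floorNα-isFloor : ∀ n → IsFloor (suc n) (floorNα (suc n))
floorNα-isFloor n with floor-exists n
... | m , fl = subst (IsFloor (suc n)) (sym (isFloor-unique fl)) fl

floorNα-shift : ∀ {p d} n → Cassini p d → 8 * suc n ≤ p + d →
  floorNα (suc n + (p + d)) ≡ p + floorNα (suc n)
floorNα-shift n cas large = isFloor-unique (isFloor-shift cas large (floorNα-isFloor n))

floorNα-step : ∀ i → floorNα (suc (suc i)) ≡ floorNα (suc i) ⊎ floorNα (suc (suc i)) ≡ suc (floorNα (suc i))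
floorNα-step i = Sum.map isFloor-unique isFloor-unique (isFloor-step (floorNα-isFloor i))

fib-stay : ∀ i → floorNα (suc (suc i)) ≡ floorNα (suc i) → fib i ≡ 0
fib-stay i stay = trans (cong (_∸ floorNα (suc i)) stay) (n∸n≡0 (floorNα (suc i)))

fib-rise : ∀ i → floorNα (suc (suc i)) ≡ suc (floorNα (suc i)) → fib i ≡ 1
fib-rise i rise = trans (cong (_∸ floorNα (suc i)) rise) (m+n∸n≡m 1 (floorNα (suc i)))

zeros-fib : ∀ i → zerosBefore fib i + floorNα (suc i) ≡ i
zeros-fib zero = refl
zeros-fib (suc i) = Sum.[ stays , rises ]′ (floorNα-step i)
  where
  open ≡-Reasoning
  stays : floorNα (suc (suc i)) ≡ floorNα (suc i) → zerosBefore fib (suc i) + floorNα (suc (suc i)) ≡ suc i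
  stays stay = begin
    zerosBefore fib (suc i) + floorNα (suc (suc i))
      ≡⟨ cong₂ (λ x y → (if isZero x then 1 else 0) + zerosBefore fib i + y) (fib-stay i stay) stay ⟩
    suc (zerosBefore fib i + floorNα (suc i))   ≡⟨ cong suc (zeros-fib i) ⟩
    suc i                                        ∎
  rises : floorNα (suc (suc i)) ≡ suc (floorNα (suc i)) → zerosBefore fib (suc i) + floorNα (suc (suc i)) ≡ suc i
  rises rise = begin
    zerosBefore fib (suc i) + floorNα (suc (suc i))
      ≡⟨ cong₂ (λ x y → (if isZero x then 1 else 0) + zerosBefore fib i + y) (fib-rise i rise) rise ⟩
    zerosBefore fib i + suc (floorNα (suc i))    ≡⟨ +-suc (zerosBefore fib i) (floorNα (suc i)) ⟩
    suc (zerosBefore fib i + floorNα (suc i))    ≡⟨ cong suc (zeros-fib i) ⟩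
    suc i                                        ∎

fib-shift : ∀ {p d} j → Cassini p d → 8 * suc (suc j) ≤ p + d → fib (j + (p + d)) ≡ fib j
fib-shift {p} {d} j cas large = begin
  floorNα (suc (suc j) + (p + d)) ∸ floorNα (suc j + (p + d))
    ≡⟨ cong₂ _∸_ (floorNα-shift (suc j) cas large)
                 (floorNα-shift j cas (≤-trans (*-monoʳ-≤ 8 (n≤1+n (suc j))) large)) ⟩
  (p + floorNα (suc (suc j))) ∸ (p + floorNα (suc j))
    ≡⟨ [m+n]∸[m+o]≡n∸o p (floorNα (suc (suc j))) (floorNα (suc j)) ⟩
  floorNα (suc (suc j)) ∸ floorNα (suc j) ∎
  where open ≡-Reasoning

zeros-fib-shift : ∀ {p d} i → Cassini p d → 8 * suc i ≤ p + d →
  zerosBefore fib (i + (p + d)) ≡ zerosBefore fib i + d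
zeros-fib-shift {p} {d} i cas large = +-cancelʳ-≡ (p + floorNα (suc i)) _ _ (begin
  zerosBefore fib (i + (p + d)) + (p + floorNα (suc i))
    ≡⟨ cong (zerosBefore fib (i + (p + d)) +_) (sym (floorNα-shift i cas large)) ⟩
  zerosBefore fib (i + (p + d)) + floorNα (suc i + (p + d))   ≡⟨ zeros-fib (i + (p + d)) ⟩
  i + (p + d)                                                  ≡⟨ cong (_+ (p + d)) (sym (zeros-fib i)) ⟩
  zerosBefore fib i + floorNα (suc i) + (p + d)               ≡⟨ regroup (zerosBefore fib i) (floorNα (suc i)) p d ⟩
  zerosBefore fib i + d + (p + floorNα (suc i))               ∎)
  where
  open ≡-Reasoning
  regroup : ∀ z f p d → z + f + (p + d) ≡ z + d + (p + f)
  regroup = solve-∀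

factor-shift : ∀ (w : ℕ → ℕ) s i n → (∀ j → j < i + n → w (j + s) ≡ w j) →
  factor w (i + s) n ≡ factor w i n
factor-shift w s i zero periodic = refl
factor-shift w s i (suc n) periodic =
  cong₂ _∷_ (periodic i (m<m+n i (s≤s z≤n)))
            (factor-shift w s (suc i) n (λ j j< → periodic j (subst (j <_) (sym (+-suc i n)) j<)))

-- (p, d) ↦ (5p + 8d, 8p + 13d) advances a Fibonacci pair by six indices.
cassini-step : ∀ {p d} → Cassini p d → Cassini (5 * p + 8 * d) (8 * p + 13 * d)
cassini-step {p} {d} (cassini cas) = cassini (begin
  (8 * p + 13 * d) * (8 * p + 13 * d)                            ≡⟨ expand p d ⟩
  64 * (p * p) + 208 * (p * d) + 168 * (d * d) + d * d           ≡⟨ cong (64 * (p * p) + 208 * (p * d) + 168 * (d * d) +_) cas ⟩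
  64 * (p * p) + 208 * (p * d) + 168 * (d * d) + (p * p + p * d + 1) ≡⟨ regroup p d ⟩
  (5 * p + 8 * d) * (5 * p + 8 * d) + (5 * p + 8 * d) * (8 * p + 13 * d) + 1 ∎)
  where
  open ≡-Reasoning
  expand : ∀ p d → (8 * p + 13 * d) * (8 * p + 13 * d) ≡ 64 * (p * p) + 208 * (p * d) + 168 * (d * d) + d * d
  expand = solve-∀
  regroup : ∀ p d → 64 * (p * p) + 208 * (p * d) + 168 * (d * d) + (p * p + p * d + 1)
                  ≡ (5 * p + 8 * d) * (5 * p + 8 * d) + (5 * p + 8 * d) * (8 * p + 13 * d) + 1
  regroup = solve-∀

-- Arbitrarily large Cassini pairs with d odd, namely (F₆ₖ, F₆ₖ₊₁),
-- starting from (0, 1) and iterating cassini-step.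
large-odd-cassini : ∀ K → Σ ℕ λ p → Σ ℕ λ t → Cassini p (suc (t + t)) × K ≤ p + suc (t + t)
large-odd-cassini zero = 0 , 0 , cassini refl , z≤n
large-odd-cassini (suc K) with large-odd-cassini K
... | p , t , cas , large =
  5 * p + 8 * suc (t + t) , 4 * p + 6 + 13 * t ,
  subst (Cassini (5 * p + 8 * suc (t + t))) (sym (odd p t)) (cassini-step cas) ,
  ≤-trans (s≤s large) (≤-by (12 * p + 19 + 40 * t) (grow p t))
  where
  odd : ∀ p t → suc ((4 * p + 6 + 13 * t) + (4 * p + 6 + 13 * t)) ≡ 8 * p + 13 * suc (t + t)
  odd = solve-∀
  grow : ∀ p t → suc (p + suc (t + t)) + (12 * p + 19 + 40 * t)
               ≡ (5 * p + 8 * suc (t + t)) + suc ((4 * p + 6 + 13 * t) + (4 * p + 6 + 13 * t))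
  grow = solve-∀

even-double : ∀ t → even (t + t) ≡ true
even-double zero = refl
even-double (suc t) rewrite +-suc t t = trans (not-involutive (even (t + t))) (even-double t)

even-+-odd : ∀ z t → even (z + suc (t + t)) ≡ not (even z)
even-+-odd zero t = cong not (even-double t)
even-+-odd (suc z) t = cong not (even-+-odd z t)

-- Shifting by a large Cassini period p + d with d odd repeats a factor of f
-- and flips the parity of the preceding zeros.
fib-parityRecurrent : ParityRecurrent fib
fib-parityRecurrent i n =
  let p , t , cas , large = large-odd-cassini (8 * suc (i + n)) in
  i + (p + suc (t + t)) ,
  factor-shift fib (p + suc (t + t)) i n
    (λ j j<i+n → fib-shift j cas (≤-trans (*-monoʳ-≤ 8 (s≤s j<i+n)) large)) ,
  trans (cong even (zeros-fib-shift i cas (≤-trans (*-monoʳ-≤ 8 (s≤s (m≤m+n i n))) large)))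
        (even-+-odd (zerosBefore fib i) t)

lemma14 : (u : List ℕ) →
    InLang tw u ⇔ ((Σ (List ℕ) λ v → InLang fib v × T v ≡ u)
                   ⊎ (Σ (List ℕ) λ v → InLang fib v × T̄ v ≡ u))
lemma14 = language-Tω fib fib-parityRecurrent
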